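{- Let $n\in\mathbb{N}$, let $$\mathcal{C}=\Big\{\emptyset,\ \{(0,0),(1,1)\},\ \{(0,1),(1,0)\},\ \{(0,0),(0,1),(1,0),(1,1)\}\Big\},$$ let $\phi:\binom{[n]}{2}\to\mathcal{C}$ be any function, and let $G=([n],\phi)$. Then $|A(G)|\in\{0\}\cup\{2^k: k\ge 1\}$.
   Context: Let $\mathcal{P}$ be the family of all subsets of $\{0,1\}\times\{0,1\}$ (constraints); note $\mathcal{C}\subseteq\mathcal{P}$. A boolean CSP on a finite set $V\subseteq\mathbb{N}$ is a pair $(V,\phi)$ with $\phi:\binom{V}{2}\to\mathcal{P}$. An assignment is a function $g:V\to\{0,1\}$; it is satisfying if $(g(a),g(b))\notin\phi(\{a,b\})$ for every pair $a<b$ in $V$ (so $\phi(\{a,b\})$ is the set of forbidden value pairs). $A(G)$ denotes the set of satisfying assignments of $G$. -}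

module Defs where

open import Data.Bool using (Bool; true; false; _∧_; _∨_; not)
open import Data.Product using (_×_; _,_)
open import Data.Nat using (ℕ; zero; suc)
open import Data.Fin using (Fin; zero; suc; _<_; _<?_)
open import Data.Fin.Properties using (all?)
open import Data.List using (List; []; _∷_; [_]; concatMap; filter; length)
open import Relation.Binary.PropositionalEquality using (_≡_)
open import Relation.Nullary using (Dec; yes; no)
open import Relation.Nullary.Decidable using (_→-dec_)
open import Data.Bool.Properties using (_≟_)

-- 𝒫 : all subsets of {0,1}×{0,1}, as characteristic functions
-- (false = 0, true = 1).  A pair is in the subset iff the function returns true.
𝒫 : Set
𝒫 = Bool × Bool → Bool

data 𝒞 : Set where
  ∅c    : 𝒞
  eqc   : 𝒞
  neqc  : 𝒞
  allc  : 𝒞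

⟦_⟧ : 𝒞 → 𝒫
⟦ ∅c ⟧   _       = false
⟦ eqc ⟧  (x , y) = (x ∧ y) ∨ (not x ∧ not y)
⟦ neqc ⟧ (x , y) = (x ∧ not y) ∨ (not x ∧ y)
⟦ allc ⟧ _       = true

-- A CSP on [n] (modelled as Fin n) : φ assigns a constraint to each pair;
-- only the values φ a b with a < b are used (so φ is a function on 2-subsets).
Satisfying : {n : ℕ} → (Fin n → Fin n → 𝒫) → (Fin n → Bool) → Set
Satisfying φ g = ∀ a b → a < b → φ a b (g a , g b) ≡ false

satisfying? : {n : ℕ} (φ : Fin n → Fin n → 𝒫) (g : Fin n → Bool) → Dec (Satisfying φ g)
satisfying? φ g = all? λ a → all? λ b → (a <? b) →-dec (φ a b (g a , g b) ≟ false)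

cons : {n : ℕ} → Bool → (Fin n → Bool) → Fin (suc n) → Bool
cons x g zero    = x
cons x g (suc i) = g i

allAssignments : (n : ℕ) → List (Fin n → Bool)
allAssignments zero    = [ (λ ()) ]
allAssignments (suc n) = concatMap (λ g → cons false g ∷ cons true g ∷ []) (allAssignments n)

numSat : {n : ℕ} → (Fin n → Fin n → 𝒫) → ℕ
numSat {n} φ = length (filter (satisfying? φ) (allAssignments n))

-- Every constraint of 𝒞 only restricts the parity g a xor g b, so the CSP is a
-- system of XOR conditions.  Eliminate the first vertex v.  If none of its
-- constraints restricts anything, g v is free and the count doubles; if one of
-- them forbids every parity, there is no solution.  Otherwise some constraint
-- between v and a vertex j forces g v = s xor g j; substituting this turns every
-- other constraint at v into a constraint at j, so the count equals that of an
-- XOR CSP on one vertex fewer.  A single vertex has 2 solutions.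
module Submission where

open import Data.Bool using (Bool; true; false; not; _∨_; _xor_)
open import Data.Bool.Properties using (xor-assoc; xor-comm; ∨-conicalˡ; ∨-conicalʳ; not-¬; ¬-not)
open import Data.Bool.Properties using () renaming (_≟_ to _≟ᵇ_)
open import Data.Fin using (Fin; zero; suc; _<_)
open import Data.Fin.Properties using (<-cmp; _≟_)
open import Data.List using (List; []; _∷_; concatMap; filter; length)
open import Data.List.Properties using (filter-≐; filter-none)
open import Data.List.Relation.Unary.All using (universal)
open import Data.Nat using (ℕ; zero; suc; _+_; _≤_; _^_; s≤s; z≤n)
open import Data.Nat.Properties using (+-suc; +-identityʳ)
open import Data.Product using (∃-syntax; _×_; _,_; proj₁; proj₂)
open import Data.Sum using (_⊎_; inj₁; inj₂)
open import Function using (_∘_)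
open import Level using (Level)
open import Relation.Binary using (tri<; tri≈; tri>)
open import Relation.Binary.PropositionalEquality using (_≡_; _≢_; refl; sym; trans; cong; cong₂; subst; module ≡-Reasoning)
open import Relation.Nullary using (yes; no; ¬_; contradiction)
open import Relation.Unary using (Pred; Decidable; _≐_; _∩_; ∁)
open import Relation.Unary.Properties using (_∩?_; ∁?)
open import Defs

module _ {a p : Level} {A : Set a} {P : Pred A p} (P? : Decidable P) where

  length-filter-concatMap-pair : ∀ {b} {B : Set b} (f h : B → A) (xs : List B) →
    length (filter P? (concatMap (λ x → f x ∷ h x ∷ []) xs)) ≡
    length (filter (P? ∘ f) xs) + length (filter (P? ∘ h) xs)
  length-filter-concatMap-pair f h [] = refl
  length-filter-concatMap-pair f h (x ∷ xs)
    with P? (f x) | length-filter-concatMap-pair f h xs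
  ... | no _  | ih with P? (h x)
  ...   | no _  = ih
  ...   | yes _ = trans (cong suc ih) (sym (+-suc _ _))
  length-filter-concatMap-pair f h (x ∷ xs)
    | yes _ | ih with P? (h x)
  ...   | no _  = cong suc ih
  ...   | yes _ = cong suc (trans (cong suc ih) (sym (+-suc _ _)))

  length-filter-split : ∀ {r} {R : Pred A r} (R? : Decidable R) (xs : List A) →
    length (filter P? xs) ≡ length (filter (P? ∩? R?) xs) + length (filter (P? ∩? ∁? R?) xs)
  length-filter-split R? [] = refl
  length-filter-split R? (x ∷ xs)
    with ih ← length-filter-split R? xs | P? x | R? x
  ... | no _  | _     = ih
  ... | yes _ | yes _ = cong suc ih
  ... | yes _ | no _  = trans (cong suc ih) (sym (+-suc _ _))

count : ∀ {n p} {P : Pred (Fin n → Bool) p} → Decidable P → ℕ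
count {n} P? = length (filter P? (allAssignments n))

module _ {n : ℕ} {p : Level} {P : Pred (Fin n → Bool) p} (P? : Decidable P) where

  count-≐ : ∀ {q} {Q : Pred (Fin n → Bool) q} (Q? : Decidable Q) → P ≐ Q → count P? ≡ count Q?
  count-≐ Q? P≐Q = cong length (filter-≐ P? Q? P≐Q (allAssignments n))

  count-∅ : (∀ g → ¬ P g) → count P? ≡ 0
  count-∅ ¬P = cong length (filter-none P? (universal ¬P (allAssignments n)))

module _ {n : ℕ} {p q : Level} {P : Pred (Fin (suc n) → Bool) p} (P? : Decidable P) where

  count-cons : count P? ≡ count (P? ∘ cons false) + count (P? ∘ cons true)
  count-cons = length-filter-concatMap-pair P? (cons false) (cons true) (allAssignments n)

  module _ {Q : Pred (Fin n → Bool) q} (Q? : Decidable Q) where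

    count-cons-free : (∀ x → P ∘ cons x ≐ Q) → count P? ≡ count Q? + count Q?
    count-cons-free P≐Q =
      trans count-cons (cong₂ _+_ (count-≐ _ Q? (P≐Q false)) (count-≐ _ Q? (P≐Q true)))

    count-cons-determined : (f : (Fin n → Bool) → Bool) →
      (∀ x → P ∘ cons x ≐ (λ g → x ≡ f g × Q g)) → count P? ≡ count Q?
    count-cons-determined f P≐ = begin
      count P?                                          ≡⟨ count-cons ⟩
      count (P? ∘ cons false) + count (P? ∘ cons true)  ≡⟨ cong₂ _+_ (count-≐ _ (Q? ∩? R?) at-false)
                                                                     (count-≐ _ (Q? ∩? ∁? R?) at-true) ⟩
      count (Q? ∩? R?) + count (Q? ∩? ∁? R?)            ≡⟨ sym (length-filter-split Q? R? (allAssignments n)) ⟩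
      count Q?                                          ∎
      where
      open ≡-Reasoning
      R? : Decidable (λ g → f g ≡ false)
      R? g = f g ≟ᵇ false

      at-false : P ∘ cons false ≐ Q ∩ (λ g → f g ≡ false)
      at-false = (λ Pg → let e , q = proj₁ (P≐ false) Pg in q , sym e)
               , (λ (q , e) → proj₂ (P≐ false) (sym e , q))

      at-true : P ∘ cons true ≐ Q ∩ ∁ (λ g → f g ≡ false)
      at-true = (λ Pg → let e , q = proj₁ (P≐ true) Pg in q , not-¬ (sym e))
              , (λ (q , e) → proj₂ (P≐ true) (sym (¬-not e) , q))

satisfying-cons : ∀ {n} (φ : Fin (suc n) → Fin (suc n) → 𝒫) (x : Bool) →
  Satisfying φ ∘ cons x ≐
  (λ g → (∀ i → φ zero (suc i) (x , g i) ≡ false) × Satisfying (λ a b → φ (suc a) (suc b)) g)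
satisfying-cons φ x =
    (λ S → (λ i → S zero (suc i) (s≤s z≤n)) , (λ a b a<b → S (suc a) (suc b) (s≤s a<b)))
  , (λ (H , S) → λ { zero zero ()
                   ; zero (suc b) _ → H b
                   ; (suc a) zero ()
                   ; (suc a) (suc b) (s≤s a<b) → S a b a<b })

numSat-cong : ∀ {n} {φ φ′ : Fin n → Fin n → 𝒫} →
  (∀ a b v → φ a b v ≡ φ′ a b v) → numSat φ ≡ numSat φ′
numSat-cong {φ = φ} {φ′} φ≗φ′ = count-≐ (satisfying? φ) (satisfying? φ′)
  ( (λ S a b a<b → trans (sym (φ≗φ′ a b _)) (S a b a<b))
  , (λ S a b a<b → trans (φ≗φ′ a b _) (S a b a<b)) )

-- κ a b is the set of forbidden values of the parity g a xor g b.
XorCSP : ℕ → Set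
XorCSP n = Fin n → Fin n → Bool → Bool

xorConstraints : ∀ {n} → XorCSP n → Fin n → Fin n → 𝒫
xorConstraints κ a b (x , y) = κ a b (x xor y)

forbiddenParity : 𝒞 → Bool → Bool
forbiddenParity ∅c   _ = false
forbiddenParity eqc  p = not p
forbiddenParity neqc p = p
forbiddenParity allc _ = true

⟦⟧-via-xor : ∀ c x y → ⟦ c ⟧ (x , y) ≡ forbiddenParity c (x xor y)
⟦⟧-via-xor ∅c   _     _     = refl
⟦⟧-via-xor allc _     _     = refl
⟦⟧-via-xor eqc  false y     = refl
⟦⟧-via-xor eqc  true  false = refl
⟦⟧-via-xor eqc  true  true  = refl
⟦⟧-via-xor neqc false y     = refl
⟦⟧-via-xor neqc true  false = refl
⟦⟧-via-xor neqc true  true  = refl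

data ParityShape (ψ : Bool → Bool) : Set where
  permissive : (∀ p → ψ p ≡ false) → ParityShape ψ
  forbidding : (∀ p → ψ p ≡ true) → ParityShape ψ
  forcing    : ∀ s → ψ s ≡ false → ψ (not s) ≡ true → ParityShape ψ

parityShape : ∀ ψ → ParityShape ψ
parityShape ψ with ψ false in e₀ | ψ true in e₁
... | false | false = permissive λ { false → e₀ ; true → e₁ }
... | true  | true  = forbidding λ { false → e₀ ; true → e₁ }
... | false | true  = forcing false e₀ e₁
... | true  | false = forcing true e₁ e₀

data StarShape {n} (ψ : Fin n → Bool → Bool) : Set where
  permissive : (∀ i p → ψ i p ≡ false) → StarShape ψ
  forbidding : ∀ i → (∀ p → ψ i p ≡ true) → StarShape ψ
  forcing    : ∀ j s → ψ j s ≡ false → ψ j (not s) ≡ true → StarShape ψ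

starShape : ∀ {n} (ψ : Fin n → Bool → Bool) → StarShape ψ
starShape {zero}  ψ = permissive λ ()
starShape {suc n} ψ with parityShape (ψ zero) | starShape (ψ ∘ suc)
... | forbidding h    | _                 = forbidding zero h
... | forcing s h₀ h₁ | _                 = forcing zero s h₀ h₁
... | permissive h    | permissive hs     = permissive λ { zero → h ; (suc i) → hs i }
... | permissive _    | forbidding i h    = forbidding (suc i) h
... | permissive _    | forcing j s h₀ h₁ = forcing (suc j) s h₀ h₁

forced-parity : ∀ {ψ : Bool → Bool} s p → ψ (not s) ≡ true → ψ p ≡ false → p ≡ s
forced-parity false false _ _ = refl
forced-parity true  true  _ _ = refl
forced-parity false true  t f = contradiction (trans (sym t) f) λ ()
forced-parity true  false t f = contradiction (trans (sym t) f) λ ()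

xor-cancelʳ : ∀ x y → (x xor y) xor y ≡ x
xor-cancelʳ false false = refl
xor-cancelʳ false true  = refl
xor-cancelʳ true  false = refl
xor-cancelʳ true  true  = refl

StarSatisfied : ∀ {n} → (Fin n → Bool → Bool) → Bool → (Fin n → Bool) → Set
StarSatisfied ψ x g = ∀ i → ψ i (x xor g i) ≡ false

starSatisfied-forcing : ∀ {n} (ψ : Fin n → Bool → Bool) j s → ψ j (not s) ≡ true →
  ∀ x g → StarSatisfied ψ x g → x ≡ s xor g j
starSatisfied-forcing ψ j s h₁ x g H = begin
  x                   ≡⟨ sym (xor-cancelʳ x (g j)) ⟩
  (x xor g j) xor g j ≡⟨ cong (_xor g j) (forced-parity {ψ j} s (x xor g j) h₁ (H j)) ⟩
  s xor g j           ∎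
  where open ≡-Reasoning

-- ψ are the constraints of a deleted vertex v whose value is forced to be
-- s xor g j; each ψ i is moved onto the pair {i, j}.
module Contraction {n} (κ : XorCSP n) (ψ : Fin n → Bool → Bool) (j : Fin n) (s : Bool) where

  viaHub : Fin n → Fin n → Bool → Bool
  viaHub a b p with a ≟ j | b ≟ j
  ... | yes _ | _     = ψ b (s xor p)
  ... | no _  | yes _ = ψ a (s xor p)
  ... | no _  | no _  = false

  contracted : XorCSP n
  contracted a b p = κ a b p ∨ viaHub a b p

  viaHub-fromHub : ∀ b p → viaHub j b p ≡ ψ b (s xor p)
  viaHub-fromHub b p with j ≟ j | b ≟ j
  ... | yes _  | _ = refl
  ... | no j≢j | _ = contradiction refl j≢j

  viaHub-toHub : ∀ a p → a ≢ j → viaHub a j p ≡ ψ a (s xor p)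
  viaHub-toHub a p a≢j with a ≟ j | j ≟ j
  ... | yes a≡j | _      = contradiction a≡j a≢j
  ... | no _    | yes _  = refl
  ... | no _    | no j≢j = contradiction refl j≢j

  contracted-correct : ψ j s ≡ false →
    (λ g → StarSatisfied ψ (s xor g j) g × Satisfying (xorConstraints κ) g) ≐
    Satisfying (xorConstraints contracted)
  contracted-correct h₀ =
      (λ (H , S) a b a<b → trans (cong (_∨ viaHub a b _) (S a b a<b)) (viaHub-satisfied H a b))
    , (λ C → hub-satisfied C , λ a b a<b → ∨-conicalˡ _ _ (C a b a<b))
    where
    reassoc : ∀ g i → s xor g j xor g i ≡ (s xor g j) xor g i
    reassoc g i = sym (xor-assoc s (g j) (g i))

    reassoc-swap : ∀ g i → s xor g i xor g j ≡ (s xor g j) xor g i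
    reassoc-swap g i = trans (cong (s xor_) (xor-comm (g i) (g j))) (reassoc g i)

    viaHub-satisfied : ∀ {g} → StarSatisfied ψ (s xor g j) g → ∀ a b → viaHub a b (g a xor g b) ≡ false
    viaHub-satisfied {g} H a b with a ≟ j | b ≟ j
    ... | yes refl | _        = trans (cong (ψ b) (reassoc g b)) (H b)
    ... | no _     | yes refl = trans (cong (ψ a) (reassoc-swap g a)) (H a)
    ... | no _     | no _     = refl

    hub-satisfied : ∀ {g} → Satisfying (xorConstraints contracted) g → StarSatisfied ψ (s xor g j) g
    hub-satisfied {g} C i with <-cmp i j
    ... | tri≈ _ refl _ = trans (cong (ψ j) (xor-cancelʳ s (g j))) h₀
    ... | tri< i<j i≢j _ = begin
      ψ i ((s xor g j) xor g i)  ≡⟨ cong (ψ i) (sym (reassoc-swap g i)) ⟩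
      ψ i (s xor g i xor g j)    ≡⟨ sym (viaHub-toHub i _ i≢j) ⟩
      viaHub i j (g i xor g j)   ≡⟨ ∨-conicalʳ _ _ (C i j i<j) ⟩
      false                      ∎
      where open ≡-Reasoning
    ... | tri> _ _ j<i = begin
      ψ i ((s xor g j) xor g i)  ≡⟨ cong (ψ i) (sym (reassoc g i)) ⟩
      ψ i (s xor g j xor g i)    ≡⟨ sym (viaHub-fromHub i _) ⟩
      viaHub j i (g j xor g i)   ≡⟨ ∨-conicalʳ _ _ (C j i j<i) ⟩
      false                      ∎
      where open ≡-Reasoning

module VertexZero {n} (κ : XorCSP (suc n)) where

  rest : XorCSP n
  rest a b = κ (suc a) (suc b)

  star : Fin n → Bool → Bool
  star i = κ zero (suc i)

  satisfying-cons-xor : ∀ x → Satisfying (xorConstraints κ) ∘ cons x ≐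
    (λ g → StarSatisfied star x g × Satisfying (xorConstraints rest) g)
  satisfying-cons-xor = satisfying-cons (xorConstraints κ)

  satisfying-cons-permissive : (∀ i p → star i p ≡ false) →
    ∀ x → Satisfying (xorConstraints κ) ∘ cons x ≐ Satisfying (xorConstraints rest)
  satisfying-cons-permissive h x =
      (λ S → proj₂ (proj₁ (satisfying-cons-xor x) S))
    , (λ S → proj₂ (satisfying-cons-xor x) ((λ i → h i _) , S))

  unsatisfiable-forbidding : ∀ i → (∀ p → star i p ≡ true) → ∀ g → ¬ Satisfying (xorConstraints κ) g
  unsatisfiable-forbidding i h g S = contradiction (trans (sym (h _)) (S zero (suc i) (s≤s z≤n))) λ ()

  module _ (j : Fin n) (s : Bool) (h₀ : star j s ≡ false) (h₁ : star j (not s) ≡ true) where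
    open Contraction rest star j s

    satisfying-cons-forcing : ∀ x → Satisfying (xorConstraints κ) ∘ cons x ≐
      (λ g → x ≡ s xor g j × Satisfying (xorConstraints contracted) g)
    satisfying-cons-forcing x =
        (λ S → let H , R = proj₁ (satisfying-cons-xor x) S
                   x≡ = starSatisfied-forcing star j s h₁ x _ H
               in x≡ , proj₁ (contracted-correct h₀) (subst (λ y → StarSatisfied star y _) x≡ H , R))
      , (λ (x≡ , C) → let H , R = proj₂ (contracted-correct h₀) C
                      in proj₂ (satisfying-cons-xor x) (subst (λ y → StarSatisfied star y _) (sym x≡) H , R))

ZeroOrPositivePowerOfTwo : ℕ → Set
ZeroOrPositivePowerOfTwo x = x ≡ 0 ⊎ ∃[ k ] (1 ≤ k × x ≡ 2 ^ k)

zeroOrPositivePowerOfTwo-double : ∀ {x} → ZeroOrPositivePowerOfTwo x → ZeroOrPositivePowerOfTwo (x + x)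
zeroOrPositivePowerOfTwo-double (inj₁ refl)           = inj₁ refl
zeroOrPositivePowerOfTwo-double (inj₂ (k , _ , refl)) =
  inj₂ (suc k , s≤s z≤n , cong (2 ^ k +_) (sym (+-identityʳ (2 ^ k))))

numSat-xor-zeroOrPositivePowerOfTwo : ∀ m (κ : XorCSP (suc m)) →
  ZeroOrPositivePowerOfTwo (numSat (xorConstraints κ))
numSat-xor-zeroOrPositivePowerOfTwo zero    κ = inj₂ (1 , s≤s z≤n , refl)
numSat-xor-zeroOrPositivePowerOfTwo (suc m) κ = byStarShape (starShape star)
  where
  open VertexZero κ

  byStarShape : StarShape star → ZeroOrPositivePowerOfTwo (numSat (xorConstraints κ))
  byStarShape (permissive h) =
    subst ZeroOrPositivePowerOfTwo
      (sym (count-cons-free (satisfying? (xorConstraints κ)) (satisfying? (xorConstraints rest))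
                            (satisfying-cons-permissive h)))
      (zeroOrPositivePowerOfTwo-double (numSat-xor-zeroOrPositivePowerOfTwo m rest))
  byStarShape (forbidding i h) =
    inj₁ (count-∅ (satisfying? (xorConstraints κ)) (unsatisfiable-forbidding i h))
  byStarShape (forcing j s h₀ h₁) =
    subst ZeroOrPositivePowerOfTwo
      (sym (count-cons-determined (satisfying? (xorConstraints κ)) (satisfying? (xorConstraints contracted))
                                  (λ g → s xor g j) (satisfying-cons-forcing j s h₀ h₁)))
      (numSat-xor-zeroOrPositivePowerOfTwo m contracted)
    where open Contraction rest star j s

lemma6 : (n : ℕ) → 1 ≤ n → (φ : Fin n → Fin n → 𝒞) →
    numSat (λ a b → ⟦ φ a b ⟧) ≡ 0 ⊎ ∃[ k ] (1 ≤ k × numSat (λ a b → ⟦ φ a b ⟧) ≡ 2 ^ k)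
lemma6 (suc m) _ φ =
  subst ZeroOrPositivePowerOfTwo
    (numSat-cong λ a b (x , y) → sym (⟦⟧-via-xor (φ a b) x y))
    (numSat-xor-zeroOrPositivePowerOfTwo m λ a b → forbiddenParity (φ a b))
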